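{- Let $\Lambda\subseteq\mathsf{FOR}$ and let $\Sigma^+$ be an $\mathcal{F}\Lambda$-maximally consistent set. Then the set of Epstein models $\mathfrak{M}$ with $\mathfrak{M}\vDash\psi$ for all $\psi\in\Sigma^+$ is exactly $\mathsf{S}^{\Sigma^+}=\{\langle v,\mathfrak{R}\rangle: v=v^{\Sigma^+},\ \mathfrak{R}^{\Sigma^+}_{\mathsf{min}}\subseteq\mathfrak{R}\subseteq\mathfrak{R}^{\Sigma^+}_{\mathsf{max}}\}$.
   Context: Let $\Phi=\{p_0,p_1,\dots\}$ be a countably infinite set of propositional letters; $\mathsf{FOR}$ is the set of formulas built from $\Phi$ with $\neg$ and binary $\lor,\wedge,\to,\leftrightarrow,\vartriangle,\looparrowright$; $\bot:=\neg(p_0\lor\neg p_0)$. An Epstein model is $\langle v,\mathfrak{R}\rangle$ with $v:\Phi\to\{0,1\}$ and $\mathfrak{R}\subseteq\mathsf{FOR}^2$. Truth: $\langle v,\mathfrak{R}\rangle\vDash p$ iff $v(p)=1$; classical clauses for $\neg,\wedge,\lor,\to,\leftrightarrow$; $\vDash\psi\vartriangle\chi$ iff both $\psi,\chi$ true and $\langle\psi,\chi\rangle\in\mathfrak{R}$; $\vDash\psi\looparrowright\chi$ iff ($\psi$ false or $\chi$ true) and $\langle\psi,\chi\rangle\in\mathfrak{R}$. $\mathcal{F}\Lambda$ is the least set of formulas containing all classical tautologies, $(p\looparrowright q)\to(p\to q)$, $(p\vartriangle q)\leftrightarrow((p\looparrowright q)\wedge(p\wedge q))$ and $\Lambda$,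 closed under uniform substitution and modus ponens. $\Gamma\vdash_{\mathcal{F}\Lambda}\varphi$ iff there is a finite sequence ending in $\varphi$ each of whose members is in $\mathcal{F}\Lambda\cup\Gamma$ or follows from earlier members by modus ponens. $\Gamma$ is $\mathcal{F}\Lambda$-consistent iff $\Gamma\nvdash_{\mathcal{F}\Lambda}\bot$, and $\mathcal{F}\Lambda$-maximally consistent iff consistent with every proper superset inconsistent. For such $\Sigma^+$: $v^{\Sigma^+}(p)=1$ iff $p\in\Sigma^+$ ($p\in\Phi$); $\mathfrak{R}^{\Sigma^+}_{\mathsf{min}}=\{\langle\varphi,\psi\rangle:\varphi\looparrowright\psi\in\Sigma^+\}$; $\mathfrak{R}^{\Sigma^+}_{\mathsf{max}}=\{\langle\varphi,\psi\rangle:\varphi\looparrowright\psi\in\Sigma^+\text{ or }\varphi\to\psi\notin\Sigma^+\}$. -}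

module Defs where

open import Data.Nat using (ℕ)
open import Data.Bool using (Bool; true; false; not; _∧_; _∨_; if_then_else_)
open import Data.Product using (_×_; ∃)
open import Relation.Binary.PropositionalEquality using (_≡_)
open import Relation.Nullary using (¬_)
open import Data.Empty using (⊥)
open import Data.Unit using (⊤)

data FOR : Set where
  var   : ℕ → FOR
  ¬'_   : FOR → FOR
  _∨'_  : FOR → FOR → FOR
  _∧'_  : FOR → FOR → FOR
  _⇒'_  : FOR → FOR → FOR
  _⇔'_  : FOR → FOR → FOR
  _▵_   : FOR → FOR → FOR
  _↬_   : FOR → FOR → FOR

⊥' : FOR
⊥' = ¬' (var 0 ∨' (¬' var 0))

FSet : Set
FSet = FOR → Bool

_∈_ : FOR → FSet → Set
φ ∈ Γ = Γ φ ≡ true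

_∉_ : FOR → FSet → Set
φ ∉ Γ = Γ φ ≡ false

Pure : FOR → Set
Pure (var _)   = ⊤
Pure (¬' φ)    = Pure φ
Pure (φ ∨' ψ)  = Pure φ × Pure ψ
Pure (φ ∧' ψ)  = Pure φ × Pure ψ
Pure (φ ⇒' ψ)  = Pure φ × Pure ψ
Pure (φ ⇔' ψ)  = Pure φ × Pure ψ
Pure (φ ▵ ψ)   = ⊥
Pure (φ ↬ ψ)   = ⊥

_⇒b_ : Bool → Bool → Bool
a ⇒b b = not a ∨ b

_⇔b_ : Bool → Bool → Bool
a ⇔b b = (a ⇒b b) ∧ (b ⇒b a)

-- classical evaluation (only used on Pure formulas)
evalC : (ℕ → Bool) → FOR → Bool
evalC v (var p)  = v p
evalC v (¬' φ)   = not (evalC v φ)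
evalC v (φ ∨' ψ) = evalC v φ ∨ evalC v ψ
evalC v (φ ∧' ψ) = evalC v φ ∧ evalC v ψ
evalC v (φ ⇒' ψ) = evalC v φ ⇒b evalC v ψ
evalC v (φ ⇔' ψ) = evalC v φ ⇔b evalC v ψ
evalC v (φ ▵ ψ)  = false
evalC v (φ ↬ ψ)  = false

Tautology : FOR → Set
Tautology φ = Pure φ × (∀ (v : ℕ → Bool) → evalC v φ ≡ true)

subst : (ℕ → FOR) → FOR → FOR
subst σ (var p)  = σ p
subst σ (¬' φ)   = ¬' subst σ φ
subst σ (φ ∨' ψ) = subst σ φ ∨' subst σ ψ
subst σ (φ ∧' ψ) = subst σ φ ∧' subst σ ψ
subst σ (φ ⇒' ψ) = subst σ φ ⇒' subst σ ψ
subst σ (φ ⇔' ψ) = subst σ φ ⇔' subst σ ψ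
subst σ (φ ▵ ψ)  = subst σ φ ▵ subst σ ψ
subst σ (φ ↬ ψ)  = subst σ φ ↬ subst σ ψ

data F (Λ : FOR → Set) : FOR → Set where
  taut : ∀ {φ} → Tautology φ → F Λ φ
  ax↬  : F Λ ((var 0 ↬ var 1) ⇒' (var 0 ⇒' var 1))
  ax▵  : F Λ ((var 0 ▵ var 1) ⇔' ((var 0 ↬ var 1) ∧' (var 0 ∧' var 1)))
  lam  : ∀ {φ} → Λ φ → F Λ φ
  us   : ∀ {φ} (σ : ℕ → FOR) → F Λ φ → F Λ (subst σ φ)
  mp   : ∀ {φ ψ} → F Λ (φ ⇒' ψ) → F Λ φ → F Λ ψ

-- Γ ⊢_{FΛ} φ (derivations from FΛ ∪ Γ by modus ponens;
-- equivalent to the finite-sequence definition)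
data _⊢[_]_ (Γ : FSet) (Λ : FOR → Set) : FOR → Set where
  thm : ∀ {φ} → F Λ φ → Γ ⊢[ Λ ] φ
  hyp : ∀ {φ} → φ ∈ Γ → Γ ⊢[ Λ ] φ
  mp  : ∀ {φ ψ} → Γ ⊢[ Λ ] (φ ⇒' ψ) → Γ ⊢[ Λ ] φ → Γ ⊢[ Λ ] ψ

Consistent : (Λ : FOR → Set) → FSet → Set
Consistent Λ Γ = ¬ (Γ ⊢[ Λ ] ⊥')

_⊆_ : FSet → FSet → Set
Γ ⊆ Δ = ∀ φ → φ ∈ Γ → φ ∈ Δ

ProperSuperset : FSet → FSet → Set
ProperSuperset Δ Γ = (Γ ⊆ Δ) × ∃ (λ φ → φ ∈ Δ × φ ∉ Γ)

MaxConsistent : (Λ : FOR → Set) → FSet → Set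
MaxConsistent Λ Γ =
  Consistent Λ Γ × (∀ Δ → ProperSuperset Δ Γ → ¬ Consistent Λ Δ)

Rel : Set
Rel = FOR → FOR → Bool

record Model : Set where
  constructor ⟨_,_⟩
  field
    val : ℕ → Bool
    rel : Rel
open Model public

⟦_⟧ : Model → FOR → Bool
⟦ M ⟧ (var p)  = val M p
⟦ M ⟧ (¬' φ)   = not (⟦ M ⟧ φ)
⟦ M ⟧ (φ ∨' ψ) = ⟦ M ⟧ φ ∨ ⟦ M ⟧ ψ
⟦ M ⟧ (φ ∧' ψ) = ⟦ M ⟧ φ ∧ ⟦ M ⟧ ψ
⟦ M ⟧ (φ ⇒' ψ) = ⟦ M ⟧ φ ⇒b ⟦ M ⟧ ψ
⟦ M ⟧ (φ ⇔' ψ) = ⟦ M ⟧ φ ⇔b ⟦ M ⟧ ψ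
⟦ M ⟧ (φ ▵ ψ)  = (⟦ M ⟧ φ ∧ ⟦ M ⟧ ψ) ∧ rel M φ ψ
⟦ M ⟧ (φ ↬ ψ)  = (not (⟦ M ⟧ φ) ∨ ⟦ M ⟧ ψ) ∧ rel M φ ψ

_⊨_ : Model → FOR → Set
M ⊨ φ = ⟦ M ⟧ φ ≡ true

vΣ : FSet → ℕ → Bool
vΣ Σ p = Σ (var p)

Rmin : FSet → Rel
Rmin Σ φ ψ = Σ (φ ↬ ψ)

Rmax : FSet → Rel
Rmax Σ φ ψ = Σ (φ ↬ ψ) ∨ not (Σ (φ ⇒' ψ))

_⊆R_ : Rel → Rel → Set
R ⊆R S = ∀ φ ψ → R φ ψ ≡ true → S φ ψ ≡ true

InS : FSet → Model → Set
InS Σ M = (∀ p → val M p ≡ vΣ Σ p) × (Rmin Σ ⊆R rel M) × (rel M ⊆R Rmax Σ)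

-- A maximal consistent set Σ⁺ is closed under derivability and contains exactly one of φ, ¬φ
-- for every φ. Together with the tautologies  lit a φ → lit b ψ → lit (a ∘ b) (φ ∘ ψ),  where
-- lit a φ states that φ has truth value a, this makes membership in Σ⁺ a truth-functional
-- valuation; the two axioms add that φ ▵ ψ ∈ Σ⁺ iff (φ ↬ ψ) ∧ (φ ∧ ψ) ∈ Σ⁺, and that φ ↬ ψ ∈ Σ⁺
-- implies φ → ψ ∈ Σ⁺. Hence a model satisfies Σ⁺ iff its truth values agree with membership
-- in Σ⁺. Since φ ↬ ψ is true iff φ → ψ is true and ⟨φ, ψ⟩ ∈ R, agreement on letters and on
-- every φ ↬ ψ says exactly that v = v^Σ⁺ and R_min ⊆ R ⊆ R_max; conversely, these bounds yield
-- agreement on all formulas by induction.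
module Submission where

open import Data.Bool using (Bool; true; false; not; _∧_; _∨_)
open import Data.Bool.Properties
  using (∨-zeroʳ; ∧-zeroʳ; ∧-identityʳ; ∧-conicalʳ; not-injective; ¬-not)
open import Data.Empty using (⊥-elim)
open import Data.List using (List; []; _∷_)
open import Data.Nat using (ℕ; zero; suc)
import Data.Nat.Properties as ℕ
open import Data.Product using (_,_; proj₁; proj₂)
open import Data.Sum using (_⊎_; inj₁; inj₂)
open import Data.Unit using (tt)
open import Function.Bundles using (_⇔_; mk⇔)
open import Relation.Binary.Definitions using (DecidableEquality)
open import Relation.Binary.PropositionalEquality
  using (_≡_; _≗_; refl; sym; trans; cong; cong₂; module ≡-Reasoning)
  renaming (subst to ≡-subst)
open import Relation.Nullary using (¬_; Dec)
open import Relation.Nullary.Decidable using (does; yes; no; map′; _×-dec_; dec-true)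
open import Relation.Nullary.Negation using (contradiction; ¬¬-map)

open import Defs

data Tree : Set where
  leaf : ℕ → Tree
  node : ℕ → Tree → Tree → Tree

_≟ᵀ_ : DecidableEquality Tree
leaf m ≟ᵀ leaf n = map′ (cong leaf) (λ { refl → refl }) (m ℕ.≟ n)
node k l r ≟ᵀ node k′ l′ r′ =
  map′ (λ { (refl , refl , refl) → refl }) (λ { refl → refl , refl , refl })
       (k ℕ.≟ k′ ×-dec l ≟ᵀ l′ ×-dec r ≟ᵀ r′)
leaf _ ≟ᵀ node _ _ _ = no λ ()
node _ _ _ ≟ᵀ leaf _ = no λ ()

encode : FOR → Tree
encode (var n)  = leaf n
encode (¬' φ)   = node 0 (encode φ) (encode φ)
encode (φ ∨' ψ) = node 1 (encode φ) (encode ψ)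
encode (φ ∧' ψ) = node 2 (encode φ) (encode ψ)
encode (φ ⇒' ψ) = node 3 (encode φ) (encode ψ)
encode (φ ⇔' ψ) = node 4 (encode φ) (encode ψ)
encode (φ ▵ ψ)  = node 5 (encode φ) (encode ψ)
encode (φ ↬ ψ)  = node 6 (encode φ) (encode ψ)

decode : Tree → FOR
decode (leaf n)     = var n
decode (node 0 l _) = ¬' decode l
decode (node 1 l r) = decode l ∨' decode r
decode (node 2 l r) = decode l ∧' decode r
decode (node 3 l r) = decode l ⇒' decode r
decode (node 4 l r) = decode l ⇔' decode r
decode (node 5 l r) = decode l ▵ decode r
decode (node 6 l r) = decode l ↬ decode r
decode (node _ _ _) = ⊥'

decode-encode : ∀ φ → decode (encode φ) ≡ φ
decode-encode (var n)  = refl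
decode-encode (¬' φ)   = cong ¬'_ (decode-encode φ)
decode-encode (φ ∨' ψ) = cong₂ _∨'_ (decode-encode φ) (decode-encode ψ)
decode-encode (φ ∧' ψ) = cong₂ _∧'_ (decode-encode φ) (decode-encode ψ)
decode-encode (φ ⇒' ψ) = cong₂ _⇒'_ (decode-encode φ) (decode-encode ψ)
decode-encode (φ ⇔' ψ) = cong₂ _⇔'_ (decode-encode φ) (decode-encode ψ)
decode-encode (φ ▵ ψ)  = cong₂ _▵_ (decode-encode φ) (decode-encode ψ)
decode-encode (φ ↬ ψ)  = cong₂ _↬_ (decode-encode φ) (decode-encode ψ)

encode-injective : ∀ {φ ψ} → encode φ ≡ encode ψ → φ ≡ ψ
encode-injective {φ} {ψ} eq = begin
  φ                 ≡⟨ sym (decode-encode φ) ⟩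
  decode (encode φ) ≡⟨ cong decode eq ⟩
  decode (encode ψ) ≡⟨ decode-encode ψ ⟩
  ψ                 ∎
  where open ≡-Reasoning

_≟_ : DecidableEquality FOR
φ ≟ ψ = map′ encode-injective (cong encode) (encode φ ≟ᵀ encode ψ)

insert : FOR → FSet → FSet
insert φ Γ χ = Γ χ ∨ does (χ ≟ φ)

⊆-insert : ∀ φ Γ → Γ ⊆ insert φ Γ
⊆-insert φ Γ χ χ∈Γ = cong (_∨ does (χ ≟ φ)) χ∈Γ

∈-insert : ∀ φ Γ → φ ∈ insert φ Γ
∈-insert φ Γ = trans (cong (Γ φ ∨_) (dec-true (φ ≟ φ) refl)) (∨-zeroʳ (Γ φ))

∨-does⁻ : ∀ {A : Set} b (a? : Dec A) → b ∨ does a? ≡ true → b ≡ true ⊎ A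
∨-does⁻ true  _       _ = inj₁ refl
∨-does⁻ false (yes a) _ = inj₂ a
∨-does⁻ false (no _)  ()

∈-insert⁻ : ∀ {φ Γ χ} → χ ∈ insert φ Γ → χ ∈ Γ ⊎ χ ≡ φ
∈-insert⁻ {φ} {Γ} {χ} = ∨-does⁻ (Γ χ) (χ ≟ φ)

insert-proper : ∀ {φ Γ} → φ ∉ Γ → ProperSuperset (insert φ Γ) Γ
insert-proper {φ} {Γ} φ∉Γ = ⊆-insert φ Γ , φ , ∈-insert φ Γ , φ∉Γ

data Conn : Set where
  ∨ᶜ ∧ᶜ ⇒ᶜ ⇔ᶜ : Conn

_⟨_⟩_ : FOR → Conn → FOR → FOR
φ ⟨ ∨ᶜ ⟩ ψ = φ ∨' ψ
φ ⟨ ∧ᶜ ⟩ ψ = φ ∧' ψ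
φ ⟨ ⇒ᶜ ⟩ ψ = φ ⇒' ψ
φ ⟨ ⇔ᶜ ⟩ ψ = φ ⇔' ψ

⟦_⟧ᶜ : Conn → Bool → Bool → Bool
⟦ ∨ᶜ ⟧ᶜ = _∨_
⟦ ∧ᶜ ⟧ᶜ = _∧_
⟦ ⇒ᶜ ⟧ᶜ = _⇒b_
⟦ ⇔ᶜ ⟧ᶜ = _⇔b_

pure-conn : ∀ c {φ ψ} → Pure φ → Pure ψ → Pure (φ ⟨ c ⟩ ψ)
pure-conn ∨ᶜ p q = p , q
pure-conn ∧ᶜ p q = p , q
pure-conn ⇒ᶜ p q = p , q
pure-conn ⇔ᶜ p q = p , q

evalC-conn : ∀ v c φ ψ → evalC v (φ ⟨ c ⟩ ψ) ≡ ⟦ c ⟧ᶜ (evalC v φ) (evalC v ψ)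
evalC-conn v ∨ᶜ φ ψ = refl
evalC-conn v ∧ᶜ φ ψ = refl
evalC-conn v ⇒ᶜ φ ψ = refl
evalC-conn v ⇔ᶜ φ ψ = refl

subst-conn : ∀ σ c φ ψ → subst σ (φ ⟨ c ⟩ ψ) ≡ subst σ φ ⟨ c ⟩ subst σ ψ
subst-conn σ ∨ᶜ φ ψ = refl
subst-conn σ ∧ᶜ φ ψ = refl
subst-conn σ ⇒ᶜ φ ψ = refl
subst-conn σ ⇔ᶜ φ ψ = refl

⟦⟧-conn : ∀ M c φ ψ → ⟦ M ⟧ (φ ⟨ c ⟩ ψ) ≡ ⟦ c ⟧ᶜ (⟦ M ⟧ φ) (⟦ M ⟧ ψ)
⟦⟧-conn M ∨ᶜ φ ψ = refl
⟦⟧-conn M ∧ᶜ φ ψ = refl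
⟦⟧-conn M ⇒ᶜ φ ψ = refl
⟦⟧-conn M ⇔ᶜ φ ψ = refl

lit : Bool → FOR → FOR
lit true  φ = φ
lit false φ = ¬' φ

litᵇ : Bool → Bool → Bool
litᵇ true  x = x
litᵇ false x = not x

pure-lit : ∀ a {φ} → Pure φ → Pure (lit a φ)
pure-lit true  p = p
pure-lit false p = p

evalC-lit : ∀ v a φ → evalC v (lit a φ) ≡ litᵇ a (evalC v φ)
evalC-lit v true  φ = refl
evalC-lit v false φ = refl

subst-lit : ∀ σ a φ → subst σ (lit a φ) ≡ lit a (subst σ φ)
subst-lit σ true  φ = refl
subst-lit σ false φ = refl

litᵇ-self : ∀ a → litᵇ a a ≡ true
litᵇ-self true  = refl
litᵇ-self false = refl

litᵇ-cong₂ : ∀ (f : Bool → Bool → Bool) a b x y →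
             litᵇ a x ⇒b (litᵇ b y ⇒b litᵇ (f a b) (f x y)) ≡ true
litᵇ-cong₂ f true  b     false y     = refl
litᵇ-cong₂ f false b     true  y     = refl
litᵇ-cong₂ f true  true  true  true  = litᵇ-self (f true true)
litᵇ-cong₂ f true  true  true  false = refl
litᵇ-cong₂ f true  false true  true  = refl
litᵇ-cong₂ f true  false true  false = litᵇ-self (f true false)
litᵇ-cong₂ f false true  false true  = litᵇ-self (f false true)
litᵇ-cong₂ f false true  false false = refl
litᵇ-cong₂ f false false false true  = refl
litᵇ-cong₂ f false false false false = litᵇ-self (f false false)

lit-schema : Conn → Bool → Bool → FOR → FOR → FOR
lit-schema c a b φ ψ = lit a φ ⇒' (lit b ψ ⇒' lit (⟦ c ⟧ᶜ a b) (φ ⟨ c ⟩ ψ))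

lit-schema-tautology : ∀ c a b → Tautology (lit-schema c a b (var 0) (var 1))
lit-schema-tautology c a b =
  (pure-lit a tt , pure-lit b tt , pure-lit (⟦ c ⟧ᶜ a b) (pure-conn c tt tt)) , valid
  where
  valid : ∀ v → evalC v (lit-schema c a b (var 0) (var 1)) ≡ true
  valid v rewrite evalC-lit v a (var 0) | evalC-lit v b (var 1)
                | evalC-lit v (⟦ c ⟧ᶜ a b) (var 0 ⟨ c ⟩ var 1) | evalC-conn v c (var 0) (var 1)
                = litᵇ-cong₂ ⟦ c ⟧ᶜ a b (v 0) (v 1)

subst-lit-schema : ∀ σ c a b φ ψ →
                   subst σ (lit-schema c a b φ ψ) ≡ lit-schema c a b (subst σ φ) (subst σ ψ)
subst-lit-schema σ c a b φ ψ =
  cong₂ _⇒'_ (subst-lit σ a φ)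
    (cong₂ _⇒'_ (subst-lit σ b ψ)
      (trans (subst-lit σ (⟦ c ⟧ᶜ a b) (φ ⟨ c ⟩ ψ)) (cong (lit (⟦ c ⟧ᶜ a b)) (subst-conn σ c φ ψ))))

⇒b-refl : ∀ a → a ⇒b a ≡ true
⇒b-refl true  = refl
⇒b-refl false = refl

⇒b-K : ∀ a b → a ⇒b (b ⇒b a) ≡ true
⇒b-K false _     = refl
⇒b-K true  false = refl
⇒b-K true  true  = refl

⇒b-S : ∀ a b c → (a ⇒b (b ⇒b c)) ⇒b ((a ⇒b b) ⇒b (a ⇒b c)) ≡ true
⇒b-S false _ _ = refl
⇒b-S true  b c = ⇒b-refl (b ⇒b c)

⇒b-¬-intro : ∀ a p → (a ⇒b not (p ∨ not p)) ⇒b not a ≡ true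
⇒b-¬-intro false _     = refl
⇒b-¬-intro true  false = refl
⇒b-¬-intro true  true  = refl

⇒b-¬-elim : ∀ a p → a ⇒b (not a ⇒b not (p ∨ not p)) ≡ true
⇒b-¬-elim false _ = refl
⇒b-¬-elim true  _ = refl

assign : List FOR → ℕ → FOR
assign []       n       = var n
assign (φ ∷ _)  zero    = φ
assign (_ ∷ φs) (suc n) = assign φs n

taut-instance : ∀ {Λ} s φs → Tautology s → F Λ (subst (assign φs) s)
taut-instance s φs t = us (assign φs) (taut {φ = s} t)

module _ {Λ : FOR → Set} where

  ⊢K : ∀ φ ψ → F Λ (φ ⇒' (ψ ⇒' φ))
  ⊢K φ ψ = taut-instance (var 0 ⇒' (var 1 ⇒' var 0)) (φ ∷ ψ ∷ [])
             (_ , λ v → ⇒b-K (v 0) (v 1))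

  ⊢I : ∀ φ → F Λ (φ ⇒' φ)
  ⊢I φ = taut-instance (var 0 ⇒' var 0) (φ ∷ []) (_ , λ v → ⇒b-refl (v 0))

  ⊢S : ∀ φ ψ χ → F Λ ((φ ⇒' (ψ ⇒' χ)) ⇒' ((φ ⇒' ψ) ⇒' (φ ⇒' χ)))
  ⊢S φ ψ χ =
    taut-instance ((var 0 ⇒' (var 1 ⇒' var 2)) ⇒' ((var 0 ⇒' var 1) ⇒' (var 0 ⇒' var 2)))
      (φ ∷ ψ ∷ χ ∷ []) (_ , λ v → ⇒b-S (v 0) (v 1) (v 2))

  -- In the two schemas for negation, var 0 is assigned to itself so that ⊥' stays ⊥'.
  ⊢¬-intro : ∀ φ → F Λ ((φ ⇒' ⊥') ⇒' (¬' φ))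
  ⊢¬-intro φ = taut-instance ((var 1 ⇒' ⊥') ⇒' (¬' var 1)) (var 0 ∷ φ ∷ [])
                 (_ , λ v → ⇒b-¬-intro (v 1) (v 0))

  ⊢¬-elim : ∀ φ → F Λ (φ ⇒' ((¬' φ) ⇒' ⊥'))
  ⊢¬-elim φ = taut-instance (var 1 ⇒' ((¬' var 1) ⇒' ⊥')) (var 0 ∷ φ ∷ [])
                (_ , λ v → ⇒b-¬-elim (v 1) (v 0))

  ⊢lit-schema : ∀ c a b φ ψ → F Λ (lit-schema c a b φ ψ)
  ⊢lit-schema c a b φ ψ =
    ≡-subst (F Λ) (subst-lit-schema (assign (φ ∷ ψ ∷ [])) c a b (var 0) (var 1))
      (taut-instance (lit-schema c a b (var 0) (var 1)) (φ ∷ ψ ∷ []) (lit-schema-tautology c a b))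

deduction : ∀ {Λ Γ φ χ} → insert φ Γ ⊢[ Λ ] χ → Γ ⊢[ Λ ] (φ ⇒' χ)
deduction (thm t) = mp (thm (⊢K _ _)) (thm t)
deduction {Γ = Γ} {φ} {χ} (hyp χ∈) with ∈-insert⁻ {φ} {Γ} {χ} χ∈
... | inj₁ χ∈Γ  = mp (thm (⊢K _ _)) (hyp χ∈Γ)
... | inj₂ refl = thm (⊢I _)
deduction (mp d e) = mp (mp (thm (⊢S _ _ _)) (deduction d)) (deduction e)

⇔b⇒≡ : ∀ {a b} → a ⇔b b ≡ true → a ≡ b
⇔b⇒≡ {true}  {true}  _ = refl
⇔b⇒≡ {false} {false} _ = refl
⇔b⇒≡ {true}  {false} ()
⇔b⇒≡ {false} {true}  ()

module MaximalConsistent {Λ : FOR → Set} {Γ : FSet} (mc : MaxConsistent Λ Γ) where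

  private
    consistent = proj₁ mc
    maximal    = proj₂ mc

  -- Maximality only yields ¬ ¬ (Δ ⊢ ⊥'), so derivations are obtained under ¬ ¬; membership,
  -- being a Boolean equation, is stable under ¬ ¬.
  ∉-refutable : ∀ {φ} → φ ∉ Γ → ¬ ¬ (Γ ⊢[ Λ ] (φ ⇒' ⊥'))
  ∉-refutable φ∉Γ ¬⊢φ⇒⊥ = maximal _ (insert-proper φ∉Γ) (λ ⊢⊥ → ¬⊢φ⇒⊥ (deduction ⊢⊥))

  ¬¬⊢⇒∈ : ∀ {φ} → ¬ ¬ (Γ ⊢[ Λ ] φ) → φ ∈ Γ
  ¬¬⊢⇒∈ {φ} ¬¬⊢φ with Γ φ in φ∈?Γ
  ... | true  = refl
  ... | false = ⊥-elim (¬¬⊢φ λ ⊢φ → ∉-refutable φ∈?Γ λ ⊢φ⇒⊥ → consistent (mp ⊢φ⇒⊥ ⊢φ))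

  ⊢⇒∈ : ∀ {φ} → Γ ⊢[ Λ ] φ → φ ∈ Γ
  ⊢⇒∈ ⊢φ = ¬¬⊢⇒∈ (λ ¬⊢φ → ¬⊢φ ⊢φ)

  ∉⇒¬'∈ : ∀ {φ} → φ ∉ Γ → (¬' φ) ∈ Γ
  ∉⇒¬'∈ {φ} φ∉Γ = ¬¬⊢⇒∈ (¬¬-map (mp (thm (⊢¬-intro φ))) (∉-refutable φ∉Γ))

  ∈⇒¬'∉ : ∀ {φ} → φ ∈ Γ → (¬' φ) ∉ Γ
  ∈⇒¬'∉ {φ} φ∈Γ = ¬-not λ ¬φ∈Γ → consistent (mp (mp (thm (⊢¬-elim φ)) (hyp φ∈Γ)) (hyp ¬φ∈Γ))

  mem-¬' : ∀ φ → Γ (¬' φ) ≡ not (Γ φ)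
  mem-¬' φ with Γ φ in φ∈?Γ
  ... | true  = ∈⇒¬'∉ φ∈?Γ
  ... | false = ∉⇒¬'∈ φ∈?Γ

  lit-∈ : ∀ φ → lit (Γ φ) φ ∈ Γ
  lit-∈ φ with Γ φ in φ∈?Γ
  ... | true  = φ∈?Γ
  ... | false = ∉⇒¬'∈ φ∈?Γ

  ∈-lit : ∀ a φ → lit a φ ∈ Γ → Γ φ ≡ a
  ∈-lit true  φ φ∈Γ  = φ∈Γ
  ∈-lit false φ ¬φ∈Γ = not-injective (trans (sym (mem-¬' φ)) ¬φ∈Γ)

  mem-conn : ∀ c φ ψ → Γ (φ ⟨ c ⟩ ψ) ≡ ⟦ c ⟧ᶜ (Γ φ) (Γ ψ)
  mem-conn c φ ψ = ∈-lit _ _ (⊢⇒∈ (mp (mp (thm (⊢lit-schema c (Γ φ) (Γ ψ) φ ψ))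
                                          (hyp (lit-∈ φ)))
                                      (hyp (lit-∈ ψ))))

  mem-↬⇒ : ∀ φ ψ → (φ ↬ ψ) ∈ Γ → (φ ⇒' ψ) ∈ Γ
  mem-↬⇒ φ ψ ↬∈Γ = ⊢⇒∈ (mp (thm (us (assign (φ ∷ ψ ∷ [])) ax↬)) (hyp ↬∈Γ))

  mem-▵ : ∀ φ ψ → Γ (φ ▵ ψ) ≡ Γ (φ ↬ ψ) ∧ Γ (φ ∧' ψ)
  mem-▵ φ ψ = trans (⇔b⇒≡ (trans (sym (mem-conn ⇔ᶜ (φ ▵ ψ) _)) ax▵∈Γ))
                    (mem-conn ∧ᶜ (φ ↬ ψ) (φ ∧' ψ))
    where
    ax▵∈Γ : ((φ ▵ ψ) ⇔' ((φ ↬ ψ) ∧' (φ ∧' ψ))) ∈ Γ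
    ax▵∈Γ = ⊢⇒∈ (thm (us (assign (φ ∷ ψ ∷ [])) ax▵))

∧-true-∨-not : ∀ a {b} → b ≡ true → a ∧ b ∨ not a ≡ true
∧-true-∨-not true  refl = refl
∧-true-∨-not false refl = refl

agrees⇒InS : ∀ {Γ M} → ⟦ M ⟧ ≗ Γ → InS Γ M
agrees⇒InS {Γ} {M} M≗Γ = (λ p → M≗Γ (var p)) , R-min⊆ , ⊆R-max
  where
  R-min⊆ : Rmin Γ ⊆R rel M
  R-min⊆ φ ψ ↬∈Γ = ∧-conicalʳ _ _ (trans (M≗Γ (φ ↬ ψ)) ↬∈Γ)

  ⊆R-max : rel M ⊆R Rmax Γ
  ⊆R-max φ ψ related = begin
    Γ (φ ↬ ψ) ∨ not (Γ (φ ⇒' ψ))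
      ≡⟨ sym (cong₂ (λ a b → a ∨ not b) (M≗Γ (φ ↬ ψ)) (M≗Γ (φ ⇒' ψ))) ⟩
    ⟦ M ⟧ (φ ⇒' ψ) ∧ rel M φ ψ ∨ not (⟦ M ⟧ (φ ⇒' ψ))
      ≡⟨ ∧-true-∨-not (⟦ M ⟧ (φ ⇒' ψ)) related ⟩
    true ∎
    where open ≡-Reasoning

∧-absorbs-⇒b : ∀ a b c → (a ∧ b) ∧ c ≡ ((a ⇒b b) ∧ c) ∧ (a ∧ b)
∧-absorbs-⇒b false _     c = sym (∧-zeroʳ c)
∧-absorbs-⇒b true  false c = refl
∧-absorbs-⇒b true  true  c = sym (∧-identityʳ c)

∧-squeeze : ∀ i r ρ → (r ≡ true → i ≡ true) → (r ≡ true → ρ ≡ true) →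
            (ρ ≡ true → r ∨ not i ≡ true) → i ∧ ρ ≡ r
∧-squeeze false false _     _  _  _  = refl
∧-squeeze false true  _     r⇒i _  _  = contradiction (r⇒i refl) λ ()
∧-squeeze true  true  _     _  r⇒ρ _  = r⇒ρ refl
∧-squeeze true  false false _  _  _  = refl
∧-squeeze true  false true  _  _  ρ⇒ = contradiction (ρ⇒ refl) λ ()

module _ {Λ : FOR → Set} {Γ : FSet} (mc : MaxConsistent Λ Γ) where
  open MaximalConsistent mc

  satisfies⇒agrees : ∀ {M} → (∀ ψ → ψ ∈ Γ → M ⊨ ψ) → ⟦ M ⟧ ≗ Γ
  satisfies⇒agrees M⊨Γ φ with Γ φ in φ∈?Γ
  ... | true  = M⊨Γ φ φ∈?Γ
  ... | false = not-injective (M⊨Γ (¬' φ) (∉⇒¬'∈ φ∈?Γ))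

  InS⇒agrees : ∀ {M} → InS Γ M → ⟦ M ⟧ ≗ Γ
  InS⇒agrees {M} (v≡ , R-min⊆ , ⊆R-max) = truth
    where
    open ≡-Reasoning

    conn-step : ∀ c {φ ψ} → ⟦ M ⟧ φ ≡ Γ φ → ⟦ M ⟧ ψ ≡ Γ ψ →
                ⟦ M ⟧ (φ ⟨ c ⟩ ψ) ≡ Γ (φ ⟨ c ⟩ ψ)
    conn-step c {φ} {ψ} φ≡ ψ≡ = begin
      ⟦ M ⟧ (φ ⟨ c ⟩ ψ)               ≡⟨ ⟦⟧-conn M c φ ψ ⟩
      ⟦ c ⟧ᶜ (⟦ M ⟧ φ) (⟦ M ⟧ ψ)     ≡⟨ cong₂ ⟦ c ⟧ᶜ φ≡ ψ≡ ⟩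
      ⟦ c ⟧ᶜ (Γ φ) (Γ ψ)             ≡⟨ sym (mem-conn c φ ψ) ⟩
      Γ (φ ⟨ c ⟩ ψ)                   ∎

    ↬-squeeze : ∀ φ ψ → Γ (φ ⇒' ψ) ∧ rel M φ ψ ≡ Γ (φ ↬ ψ)
    ↬-squeeze φ ψ = ∧-squeeze _ _ _ (mem-↬⇒ φ ψ) (R-min⊆ φ ψ) (⊆R-max φ ψ)

    truth : ⟦ M ⟧ ≗ Γ
    truth (var p)  = v≡ p
    truth (¬' φ)   = trans (cong not (truth φ)) (sym (mem-¬' φ))
    truth (φ ∨' ψ) = conn-step ∨ᶜ (truth φ) (truth ψ)
    truth (φ ∧' ψ) = conn-step ∧ᶜ (truth φ) (truth ψ)
    truth (φ ⇒' ψ) = conn-step ⇒ᶜ (truth φ) (truth ψ)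
    truth (φ ⇔' ψ) = conn-step ⇔ᶜ (truth φ) (truth ψ)
    truth (φ ↬ ψ)  = trans (cong (_∧ rel M φ ψ) (conn-step ⇒ᶜ (truth φ) (truth ψ)))
                           (↬-squeeze φ ψ)
    truth (φ ▵ ψ)  = begin
      (⟦ M ⟧ φ ∧ ⟦ M ⟧ ψ) ∧ rel M φ ψ           ≡⟨ cong (_∧ rel M φ ψ) (cong₂ _∧_ (truth φ) (truth ψ)) ⟩
      (Γ φ ∧ Γ ψ) ∧ rel M φ ψ                   ≡⟨ ∧-absorbs-⇒b (Γ φ) (Γ ψ) (rel M φ ψ) ⟩
      ((Γ φ ⇒b Γ ψ) ∧ rel M φ ψ) ∧ (Γ φ ∧ Γ ψ)  ≡⟨ sym (cong₂ (λ i k → (i ∧ rel M φ ψ) ∧ k)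
                                                        (mem-conn ⇒ᶜ φ ψ) (mem-conn ∧ᶜ φ ψ)) ⟩
      (Γ (φ ⇒' ψ) ∧ rel M φ ψ) ∧ Γ (φ ∧' ψ)     ≡⟨ cong (_∧ Γ (φ ∧' ψ)) (↬-squeeze φ ψ) ⟩
      Γ (φ ↬ ψ) ∧ Γ (φ ∧' ψ)                    ≡⟨ sym (mem-▵ φ ψ) ⟩
      Γ (φ ▵ ψ)                                 ∎

mainTheorem16 : (Λ : FOR → Set) (Σ⁺ : FSet) → MaxConsistent Λ Σ⁺ →
                (M : Model) → ((∀ ψ → ψ ∈ Σ⁺ → M ⊨ ψ) ⇔ InS Σ⁺ M)
mainTheorem16 Λ Σ⁺ mc M = mk⇔
  (λ M⊨Σ⁺ → agrees⇒InS (satisfies⇒agrees mc M⊨Σ⁺))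
  (λ M∈S ψ ψ∈Σ⁺ → trans (InS⇒agrees mc M∈S ψ) ψ∈Σ⁺)
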